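{- If $\mathscr{M}=(S,\rho)$ is a matroid scheme and $x\in F(\mathscr{M})$ is a flat, then the poset of flats of the localization $\mathscr{M}_x=(S_{\le x},\rho|_{S_{\le x}})$ is $F(\mathscr{M}_x)=F(\mathscr{M})_{\le x}$.
   Context: A finite poset $S$ is a simplicial poset if it has a unique minimum, is ranked, and each $S_{\le x}$ is isomorphic to the Boolean lattice of subsets of the atoms below $x$; $|x|$ is the rank. $x\vee y$ / $x\wedge y$ are the sets of minimal common upper / maximal common lower bounds. A matroid scheme is $(S,\rho)$, $\rho:S\to\mathbb{Z}_{\ge0}$, with (M1) $0\le\rho(x)\le|x|$; (M2) monotone; (M3) $u\in x\vee y\Rightarrow\rho(x)+\rho(y)\ge\rho(u)+\rho(x\wedge y)$; (M4) $\ell\in x\wedge y,\ \rho(x)=\rho(\ell)\Rightarrow x\vee y\neq\emptyset$; (M5) $\rho(x)<\rho(y)\Rightarrow$ there is an atom $a\le y$, $a\not\le x$, $x\vee a\ne\emptyset$. The closure $\mathrm{cl}(x)$ is the unique maximal element of $\{y\ge x:\rho(y)=\rho(x)\}$; $x$ is a flat if $\mathrm{cl}(x)=x$; $F(\mathscr{M})$ is the subposet of flats and $F(\mathscr{M})_{\le x}$ its elements below $x$. The localization $\mathscr{M}_x$ (a matroid on the Boolean lattice $S_{\le x}$, itself a matroid scheme) has flats defined by the same closure construction within $S_{\le x}$. -}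

module Defs where

open import Data.Bool using (Bool; T)
open import Data.Nat using (ℕ; zero; suc; _+_; _≤_; _<_)
open import Data.Product using (Σ; ∃; _×_; _,_; proj₁; proj₂)
open import Data.Sum using (_⊎_)
open import Data.List using (List)
open import Data.List.Membership.Propositional using (_∈_)
open import Data.Fin.Subset using (Subset; _⊆_)
open import Function.Bundles using (_↔_; Inverse; _⇔_)
open import Relation.Binary.PropositionalEquality using (_≡_; _≢_)
open import Relation.Nullary using (¬_)

module Generic {A : Set} (_⊑_ : A → A → Set) (ρ : A → ℕ) where

  SameRankAbove : A → A → Set
  SameRankAbove x y = x ⊑ y × ρ y ≡ ρ x

  IsMaximalIn : (A → Set) → A → Set
  IsMaximalIn P c = P c × (∀ y → P y → c ⊑ y → y ≡ c)

  IsClosure : A → A → Set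
  IsClosure x c = IsMaximalIn (SameRankAbove x) c
                × (∀ c' → IsMaximalIn (SameRankAbove x) c' → c' ≡ c)

  IsFlat : A → Set
  IsFlat x = IsClosure x x

-- Finite simplicial posets.  The order is Bool-valued (hence decidable and
-- proof-irrelevant, so that equality in the subtype S_{≤x} is equality of
-- underlying elements).

record SimplicialPoset : Set₁ where
  field
    Carrier  : Set
    elems    : List Carrier
    complete : ∀ x → x ∈ elems
    _≤ᵇ_     : Carrier → Carrier → Bool

  infix 4 _≤ₛ_ _<ₛ_ _⋖_
  _≤ₛ_ : Carrier → Carrier → Set
  x ≤ₛ y = T (x ≤ᵇ y)

  _<ₛ_ : Carrier → Carrier → Set
  x <ₛ y = x ≤ₛ y × x ≢ y

  _⋖_ : Carrier → Carrier → Set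
  x ⋖ y = x <ₛ y × (∀ z → x ≤ₛ z → z ≤ₛ y → z ≡ x ⊎ z ≡ y)

  Below : Carrier → Set
  Below x = Σ Carrier (λ y → y ≤ₛ x)

  field
    ≤-refl    : ∀ x → x ≤ₛ x
    ≤-antisym : ∀ {x y} → x ≤ₛ y → y ≤ₛ x → x ≡ y
    ≤-trans   : ∀ {x y z} → x ≤ₛ y → y ≤ₛ z → x ≤ₛ z
    bot       : Carrier
    bot-min   : ∀ x → bot ≤ₛ x
    ∣_∣       : Carrier → ℕ
    rank-bot  : ∣ bot ∣ ≡ 0
    rank-cover : ∀ {x y} → x ⋖ y → ∣ y ∣ ≡ suc ∣ x ∣
    boolean   : ∀ x → Σ ℕ λ k → Σ (Below x ↔ Subset k) λ f →
                  ∀ (y z : Below x) →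
                    (proj₁ y ≤ₛ proj₁ z) ⇔ (Inverse.to f y ⊆ Inverse.to f z)

  IsAtom : Carrier → Set
  IsAtom a = bot ⋖ a

  _∈∨_ : Carrier → Carrier × Carrier → Set
  u ∈∨ (x , y) = x ≤ₛ u × y ≤ₛ u
               × (∀ v → x ≤ₛ v → y ≤ₛ v → v ≤ₛ u → v ≡ u)

  _∈∧_ : Carrier → Carrier × Carrier → Set
  l ∈∧ (x , y) = l ≤ₛ x × l ≤ₛ y
               × (∀ v → v ≤ₛ x → v ≤ₛ y → l ≤ₛ v → v ≡ l)

  JoinExists : Carrier → Carrier → Set
  JoinExists x y = ∃ λ u → u ∈∨ (x , y)

record MatroidScheme : Set₁ where
  field
    S : SimplicialPoset
  open SimplicialPoset S public
  field
    ρ  : Carrier → ℕ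
    M1 : ∀ x → ρ x ≤ ∣ x ∣
    M2 : ∀ {x y} → x ≤ₛ y → ρ x ≤ ρ y
    M3 : ∀ x y u l → u ∈∨ (x , y) → l ∈∧ (x , y) → ρ u + ρ l ≤ ρ x + ρ y
    M4 : ∀ x y l → l ∈∧ (x , y) → ρ x ≡ ρ l → JoinExists x y
    M5 : ∀ x y → ρ x < ρ y →
           ∃ λ a → IsAtom a × a ≤ₛ y × ¬ (a ≤ₛ x) × JoinExists x a

  IsFlat : Carrier → Set
  IsFlat = Generic.IsFlat _≤ₛ_ ρ

  IsLocalFlat : (x : Carrier) → Below x → Set
  IsLocalFlat x = Generic.IsFlat (λ (y z : Below x) → proj₁ y ≤ₛ proj₁ z)
                                 (λ y → ρ (proj₁ y))

-- Since the order is reflexive, x is a flat exactly when no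
-- y ≥ x other than x has the rank of x; the uniqueness part of the closure
-- comes for free.  For y ≤ x with x a flat, it therefore suffices to show
-- that every z ≥ y with ρ z = ρ y already lies below x.  Take a maximal
-- common lower bound ℓ of z and x above y (it exists by finiteness).  Then
-- ρ ℓ = ρ z, so (M4) yields a join u ∈ z ∨ x, and (M3) gives
-- ρ u + ρ ℓ ≤ ρ z + ρ x, i.e. ρ u ≤ ρ x.  As x ≤ u and x is a flat, u = x,
-- hence z ≤ x.
module Submission where

open import Defs
open import Data.Bool using (true; false; T)
open import Data.Bool.Properties using (T-irrelevant; T?)
open import Data.Empty using (⊥-elim)
open import Data.List using (List; []; _∷_)
open import Data.List.Membership.Propositional using (_∈_; find; lose)
open import Data.List.Relation.Unary.Any using (here; there; any?)
open import Data.Nat using (ℕ; suc; _+_; _≤_; _<_; s≤s; z≤n)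
open import Data.Nat.Induction using (<-wellFounded)
open import Data.Nat.Properties as ℕ using (+-comm; +-cancelʳ-≤; m≤n⇒m≤1+n)
open import Data.Product using (∃; _×_; _,_; proj₁; proj₂)
open import Data.Unit using (tt)
open import Function.Bundles using (_⇔_; mk⇔; Equivalence)
open import Function.Related.Propositional using (module EquationalReasoning)
open import Function.Construct.Symmetry using (⇔-sym)
open import Induction.WellFounded using (Acc; acc; WellFounded)
open import Level using (0ℓ)
open import Relation.Binary.Construct.On as On using ()
open import Relation.Binary.PropositionalEquality
  using (_≡_; refl; sym; cong; subst; subst₂)
open import Relation.Nullary using (¬_; yes; no; _×-dec_; ¬?)
open import Relation.Unary using (Pred; Decidable)

module _ {A : Set} (_⊑_ : A → A → Set) (ρ : A → ℕ) where
  open Generic _⊑_ ρ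

  IsRankMaximal : A → Set
  IsRankMaximal x = ∀ y → x ⊑ y → ρ y ≡ ρ x → y ≡ x

  isFlat⇔isRankMaximal : (∀ x → x ⊑ x) → ∀ x → IsFlat x ⇔ IsRankMaximal x
  isFlat⇔isRankMaximal ⊑-refl x = mk⇔ to from
    where
    to : IsFlat x → IsRankMaximal x
    to ((_ , maximal) , _) y x⊑y ρy≡ρx = maximal y (x⊑y , ρy≡ρx) x⊑y

    from : IsRankMaximal x → IsFlat x
    from rankMaximal = (sameRank , maximal) , unique
      where
      sameRank : SameRankAbove x x
      sameRank = ⊑-refl x , refl

      maximal : ∀ y → SameRankAbove x y → x ⊑ y → y ≡ x
      maximal y (x⊑y , ρy≡ρx) _ = rankMaximal y x⊑y ρy≡ρx

      unique : ∀ c → IsMaximalIn (SameRankAbove x) c → c ≡ x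
      unique c ((x⊑c , ρc≡ρx) , _) = rankMaximal c x⊑c ρc≡ρx

module SimplicialPosetProperties (S : SimplicialPoset) where
  open SimplicialPoset S

  Below-≡ : ∀ {x} {y z : Below x} → proj₁ y ≡ proj₁ z → y ≡ z
  Below-≡ {y = y , y≤x} {z = .y , z≤x} refl = cong (y ,_) (T-irrelevant y≤x z≤x)

  countNotBelow : Carrier → List Carrier → ℕ
  countNotBelow v [] = 0
  countNotBelow v (e ∷ es) with e ≤ᵇ v
  ... | true  = countNotBelow v es
  ... | false = suc (countNotBelow v es)

  countNotBelow-antitone : ∀ {v w} → v ≤ₛ w → ∀ es →
                           countNotBelow w es ≤ countNotBelow v es
  countNotBelow-antitone v≤w [] = z≤n
  countNotBelow-antitone {v} {w} v≤w (e ∷ es) with e ≤ᵇ v in e≤ᵇv | e ≤ᵇ w in e≤ᵇw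
  ... | true  | true  = countNotBelow-antitone v≤w es
  ... | false | true  = m≤n⇒m≤1+n (countNotBelow-antitone v≤w es)
  ... | false | false = s≤s (countNotBelow-antitone v≤w es)
  ... | true  | false = ⊥-elim (subst T e≤ᵇw (≤-trans (subst T (sym e≤ᵇv) tt) v≤w))

  countNotBelow-strict : ∀ {v w} → v ≤ₛ w → ¬ w ≤ₛ v → ∀ {es} → w ∈ es →
                         countNotBelow w es < countNotBelow v es
  countNotBelow-strict {v} v≤w w≰v {e ∷ es} (here refl) with e ≤ᵇ v in e≤ᵇv | e ≤ᵇ e in e≤ᵇe
  ... | true  | _     = ⊥-elim (w≰v tt)
  ... | false | true  = s≤s (countNotBelow-antitone v≤w es)
  ... | false | false = ⊥-elim (subst T e≤ᵇe (≤-refl e))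
  countNotBelow-strict {v} {w} v≤w w≰v {e ∷ es} (there w∈es) with e ≤ᵇ v in e≤ᵇv | e ≤ᵇ w in e≤ᵇw
  ... | true  | true  = countNotBelow-strict v≤w w≰v w∈es
  ... | false | true  = m≤n⇒m≤1+n (countNotBelow-strict v≤w w≰v w∈es)
  ... | false | false = s≤s (countNotBelow-strict v≤w w≰v w∈es)
  ... | true  | false = ⊥-elim (subst T e≤ᵇw (≤-trans (subst T (sym e≤ᵇv) tt) v≤w))

  -- Moving strictly up shrinks the set of elements not below, so climbing
  -- through a finite poset terminates.
  _⊐_ : Carrier → Carrier → Set
  w ⊐ v = countNotBelow w elems < countNotBelow v elems

  ⊐-wellFounded : WellFounded _⊐_
  ⊐-wellFounded = On.wellFounded (λ u → countNotBelow u elems) <-wellFounded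

  maximal-above : {P : Pred Carrier 0ℓ} → Decidable P → ∀ {v} → P v →
                  ∃ λ m → v ≤ₛ m × P m × (∀ w → P w → m ≤ₛ w → w ≡ m)
  maximal-above {P} P? Pv = go (⊐-wellFounded _) Pv
    where
    go : ∀ {v} → Acc _⊐_ v → P v →
         ∃ λ m → v ≤ₛ m × P m × (∀ w → P w → m ≤ₛ w → w ≡ m)
    go {v} (acc rec) Pv
      with any? (λ w → P? w ×-dec T? (v ≤ᵇ w) ×-dec ¬? (T? (w ≤ᵇ v))) elems
    ... | yes someAbove =
      let w , w∈elems , (Pw , v≤w , w≰v) = find someAbove
          m , w≤m , Pm , maximal = go (rec (countNotBelow-strict v≤w w≰v w∈elems)) Pw
      in m , ≤-trans v≤w w≤m , Pm , maximal
    ... | no noneAbove = v , ≤-refl v , Pv , maximal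
      where
      maximal : ∀ w → P w → v ≤ₛ w → w ≡ v
      maximal w Pw v≤w with T? (w ≤ᵇ v)
      ... | yes w≤v = ≤-antisym w≤v v≤w
      ... | no w≰v = ⊥-elim (noneAbove (lose (complete w) (Pw , v≤w , w≰v)))

  meet-above : ∀ {v x y} → v ≤ₛ x → v ≤ₛ y → ∃ λ l → l ∈∧ (x , y) × v ≤ₛ l
  meet-above {x = x} {y} v≤x v≤y =
    let l , v≤l , (l≤x , l≤y) , maximal =
          maximal-above (λ w → T? (w ≤ᵇ x) ×-dec T? (w ≤ᵇ y)) (v≤x , v≤y)
    in l , (l≤x , l≤y , λ w w≤x w≤y → maximal w (w≤x , w≤y)) , v≤l

module MatroidSchemeProperties (𝓜 : MatroidScheme) where
  open MatroidScheme 𝓜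
  open SimplicialPosetProperties S

  isFlat⇔isRankMaximalₛ : ∀ x → IsFlat x ⇔ IsRankMaximal _≤ₛ_ ρ x
  isFlat⇔isRankMaximalₛ = isFlat⇔isRankMaximal _≤ₛ_ ρ ≤-refl

  _≤↓_ : ∀ {x} → Below x → Below x → Set
  y ≤↓ z = proj₁ y ≤ₛ proj₁ z

  isLocalFlat⇔isLocallyRankMaximal : ∀ x (y : Below x) →
                 IsLocalFlat x y ⇔ IsRankMaximal _≤↓_ (λ z → ρ (proj₁ z)) y
  isLocalFlat⇔isLocallyRankMaximal x =
    isFlat⇔isRankMaximal _≤↓_ (λ z → ρ (proj₁ z)) (λ z → ≤-refl (proj₁ z))

  ≤-flat-of-sameRankMeet : ∀ {x z l} → IsFlat x → l ∈∧ (z , x) → ρ z ≡ ρ l → z ≤ₛ x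
  ≤-flat-of-sameRankMeet {x} {z} {l} flat l∈z∧x ρz≡ρl
    with M4 z x l l∈z∧x ρz≡ρl
  ... | u , u∈z∨x@(z≤u , x≤u , _) = subst (z ≤ₛ_) u≡x z≤u
    where
    submodular : ρ u + ρ z ≤ ρ x + ρ z
    submodular = subst₂ _≤_ (cong (ρ u +_) (sym ρz≡ρl)) (+-comm (ρ z) (ρ x))
                        (M3 z x u l u∈z∨x l∈z∧x)

    u≡x : u ≡ x
    u≡x = Equivalence.to (isFlat⇔isRankMaximalₛ x) flat u x≤u
            (ℕ.≤-antisym (+-cancelʳ-≤ (ρ z) (ρ u) (ρ x) submodular) (M2 x≤u))

  sameRankAbove-≤-flat : ∀ {x y z} → IsFlat x → y ≤ₛ x → y ≤ₛ z → ρ z ≡ ρ y → z ≤ₛ x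
  sameRankAbove-≤-flat {z = z} flat y≤x y≤z ρz≡ρy
    with meet-above y≤z y≤x
  ... | l , l∈z∧x@(l≤z , _) , y≤l = ≤-flat-of-sameRankMeet flat l∈z∧x ρz≡ρl
    where
    ρz≡ρl : ρ z ≡ ρ l
    ρz≡ρl = ℕ.≤-antisym (subst (_≤ ρ l) (sym ρz≡ρy) (M2 y≤l)) (M2 l≤z)

  isLocallyRankMaximal⇔isRankMaximal :
    ∀ {x} → IsFlat x → (y : Below x) →
    IsRankMaximal _≤↓_ (λ z → ρ (proj₁ z)) y ⇔ IsRankMaximal _≤ₛ_ ρ (proj₁ y)
  isLocallyRankMaximal⇔isRankMaximal flat (y , y≤x) = mk⇔ to from
    where
    to : IsRankMaximal _≤↓_ (λ z → ρ (proj₁ z)) (y , y≤x) → IsRankMaximal _≤ₛ_ ρ y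
    to locallyMaximal z y≤z ρz≡ρy =
      cong proj₁ (locallyMaximal (z , sameRankAbove-≤-flat flat y≤x y≤z ρz≡ρy) y≤z ρz≡ρy)

    from : IsRankMaximal _≤ₛ_ ρ y → IsRankMaximal _≤↓_ (λ z → ρ (proj₁ z)) (y , y≤x)
    from maximal (z , _) y≤z ρz≡ρy = Below-≡ (maximal z y≤z ρz≡ρy)

proposition5p7 : (𝓜 : MatroidScheme) → let open MatroidScheme 𝓜 in
    (x : Carrier) → IsFlat x →
    (y : Below x) → IsLocalFlat x y ⇔ IsFlat (proj₁ y)
proposition5p7 𝓜 x flat y = begin
  IsLocalFlat x y                            ∼⟨ isLocalFlat⇔isLocallyRankMaximal x y ⟩
  IsRankMaximal _≤↓_ (λ z → ρ (proj₁ z)) y   ∼⟨ isLocallyRankMaximal⇔isRankMaximal flat y ⟩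
  IsRankMaximal _≤ₛ_ ρ (proj₁ y)             ∼⟨ ⇔-sym (isFlat⇔isRankMaximalₛ (proj₁ y)) ⟩
  IsFlat (proj₁ y)                           ∎
  where
  open MatroidScheme 𝓜
  open MatroidSchemeProperties 𝓜
  open EquationalReasoning
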